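{- Let $D$ be a diagram. Suppose there exist $D^*\in\mathcal{P}(D)$ and positive integers $r,c_1,c_2$ such that (i) $c_1<c_2$; (ii) $(r+1,c_1),(r+2,c_2)\in D^*$; (iii) $(r,c_2)\notin D^*$ and $(r+2,\tilde c)\notin D^*$ for all $\tilde c>c_2$; (iv) $(r,c_1)\notin D^*$ and $(r+1,\tilde c)\notin D^*$ for all $\tilde c>c_1$. Then $\mathcal{P}(D)$ is not shellable.
   Context: A diagram is a finite set of cells in $\mathbb{Z}_{>0}\times\mathbb{Z}_{>0}$; a cell $(r,c)$ lies in row $r$ (rows numbered from the bottom, starting at $1$) and column $c$. Applying a Kohnert move at row $r$ of a diagram $D$: if row $r$ is nonempty, let $(r,c)$ be its rightmost cell; if there is $r'$ with $1\le r'<r$ and $(r',c)\notin D$, take the largest such $r'$ and replace $(r,c)$ by $(r',c)$; otherwise $D$ is unchanged. The Kohnert poset $\mathcal{P}(D)$ is the set of diagrams obtainable from $D$ by finite (possibly empty) sequences of Kohnert moves, with $D_2\preceq D_1$ iff $D_2$ can be obtained from $D_1$ by Kohnert moves. A finite poset is shellable if its order complex (the simplicial complex of its chains) is shellable: its facets can be ordered $F_1,\dots,F_t$ so that for each $2\le k\le t$ the complex $\left(\bigcup_{i<k}\overline{F_i}\right)\cap\overline{F_k}$ is pure of dimension $\dim F_k-1$ ($\overline F$ = all subsets of $F$, $\dim F=|F|-1$). -}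

module Defs where

open import Data.Bool using (Bool; true; false; if_then_else_; not; _∧_; _∨_)
open import Data.Nat using (ℕ; zero; suc; _≤_; _<_; _∸_; _⊔_; _<ᵇ_; _≡ᵇ_)
open import Data.Maybe using (Maybe; just; nothing)
open import Data.Product using (_×_; _,_; Σ; ∃; proj₁; proj₂)
open import Data.Sum using (_⊎_)
open import Data.List using (List; []; _∷_; foldr; filterᵇ; length; lookup)
open import Data.Bool.ListAction using (any)
open import Data.List.Membership.Propositional using (_∈_)
open import Data.List.Relation.Binary.Subset.Propositional using (_⊆_)
open import Data.List.Relation.Unary.All using (All)
open import Data.List.Relation.Unary.Unique.Propositional using (Unique)
open import Data.Fin using (Fin; toℕ)
open import Relation.Binary.PropositionalEquality using (_≡_)
open import Relation.Binary.Construct.Closure.ReflexiveTransitive using (Star)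
open import Relation.Nullary using (¬_)

-- A cell (r , c): row r (numbered from the bottom, starting at 1), column c.
Cell : Set
Cell = ℕ × ℕ

row : Cell → ℕ
row = proj₁

col : Cell → ℕ
col = proj₂

-- Inside the Kohnert
-- poset we always work with the canonical representative: the list sorted
-- strictly increasingly in lexicographic order (no duplicates), so that two
-- diagrams are equal as sets iff their canonical lists are equal (≡).
Diagram : Set
Diagram = List Cell

IsDiagram : List Cell → Set
IsDiagram D = All (λ x → 1 ≤ row x × 1 ≤ col x) D

cellEqᵇ : Cell → Cell → Bool
cellEqᵇ (a , b) (c , d) = (a ≡ᵇ c) ∧ (b ≡ᵇ d)

cellLtᵇ : Cell → Cell → Bool
cellLtᵇ (a , b) (c , d) = (a <ᵇ c) ∨ ((a ≡ᵇ c) ∧ (b <ᵇ d))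

insertCell : Cell → List Cell → List Cell
insertCell x [] = x ∷ []
insertCell x (y ∷ ys) =
  if cellEqᵇ x y then y ∷ ys
  else if cellLtᵇ x y then x ∷ y ∷ ys
  else y ∷ insertCell x ys

canon : List Cell → Diagram
canon = foldr insertCell []

memᵇ : Cell → Diagram → Bool
memᵇ x D = any (cellEqᵇ x) D

removeCell : Cell → Diagram → Diagram
removeCell x D = filterᵇ (λ y → not (cellEqᵇ x y)) D

maxCol : ℕ → Diagram → Maybe ℕ
maxCol r [] = nothing
maxCol r ((a , b) ∷ D) with maxCol r D
... | nothing = if a ≡ᵇ r then just b else nothing
... | just m  = if a ≡ᵇ r then just (b ⊔ m) else just m

findFree : ℕ → ℕ → Diagram → Maybe ℕ
findFree zero    c D = nothing
findFree (suc k) c D = if memᵇ (suc k , c) D then findFree k c D else just (suc k)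

kohnert : ℕ → Diagram → Diagram
kohnert r D with maxCol r D
... | nothing = D
... | just c with findFree (r ∸ 1) c D
...   | nothing = D
...   | just r' = insertCell (r' , c) (removeCell (r , c) D)

KStep : Diagram → Diagram → Set
KStep D₁ D₂ = ∃ λ r → D₂ ≡ kohnert r D₁

_⪯_ : Diagram → Diagram → Set
D₂ ⪯ D₁ = Star KStep D₁ D₂

InP : List Cell → Diagram → Set
InP D E = E ⪯ canon D

-- A face of the order complex: a chain, i.e. a finite set (duplicate-free
-- list) of elements of 𝒫(D), pairwise comparable.
IsChain : List Cell → List Diagram → Set
IsChain D F =
  All (InP D) F × Unique F ×
  (∀ {x y} → x ∈ F → y ∈ F → (x ⪯ y) ⊎ (y ⪯ x))

IsMaxChain : List Cell → List Diagram → Set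
IsMaxChain D F = IsChain D F × (∀ G → IsChain D G → F ⊆ G → G ⊆ F)

-- For a list of facets Fs and a position k, the faces of the complex
-- (⋃_{i<k} closure(F_i)) ∩ closure(F_k).
InIntersection : (Fs : List (List Diagram)) → Fin (length Fs) → List Diagram → Set
InIntersection Fs k G =
  Unique G × G ⊆ lookup Fs k ×
  Σ (Fin (length Fs)) (λ i → toℕ i < toℕ k × G ⊆ lookup Fs i)

-- that complex is pure of dimension dim F_k - 1: every facet (maximal face)
-- has dimension dim F_k - 1, i.e. cardinality |F_k| - 1.
PureCondition : (Fs : List (List Diagram)) → Fin (length Fs) → Set
PureCondition Fs k =
  ∀ G → InIntersection Fs k G →
    (∀ H → InIntersection Fs k H → G ⊆ H → H ⊆ G) →
    suc (length G) ≡ length (lookup Fs k)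

-- 𝒫(D) is shellable: its facets (maximal chains) can be listed
-- F_1, …, F_t (each exactly once) such that the shelling condition
-- holds for every 2 ≤ k ≤ t (0-based: 1 ≤ k).
Shellable : List Cell → Set
Shellable D =
  Σ (List (List Diagram)) λ Fs →
    (∀ i → IsMaxChain D (lookup Fs i)) ×
    (∀ M → IsMaxChain D M → Σ (Fin (length Fs)) λ i → M ⊆ lookup Fs i × lookup Fs i ⊆ M) ×
    (∀ i j → lookup Fs i ⊆ lookup Fs j → lookup Fs j ⊆ lookup Fs i → i ≡ j) ×
    (∀ k → 1 ≤ toℕ k → PureCondition Fs k)

-- Let s₂ = (r + 2 , c₂) and q₁ = (r + 1 , c₁).  In D* both are the rightmost
-- cells of their rows and can be lowered one row at a time: lowering s₂ twice
-- and then q₁, or q₁ and then s₂ twice, gives two chains D* ≻ X₁ ≻ X₂ ≻ B and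
-- D* ≻ Y₁ ≻ Y₂ ≻ B with the same ends, since moves of different cells commute.
-- The weight (sum of the rows of the cells) drops by exactly one at each step,
-- and an analysis of which cells two consecutive such moves can vacate shows
-- that the only elements strictly between B and D* comparable with X₁ or X₂
-- are X₁ and X₂ themselves (likewise for Y).  So replacing X₁, X₂ by Y₁, Y₂ in
-- a maximal chain through the first route gives another maximal chain, and
-- whichever of the two facets comes later in a shelling meets the earlier
-- ones in a face that is maximal there but has two vertices fewer, contradicting
-- purity.

module Submission where

open import Defs
open import Data.Nat using (ℕ; zero; suc; _≤_; _<_; _+_; _∸_; _≡ᵇ_; z≤n; s≤s)
open import Data.Nat.Properties
open import Data.Bool using (true; false)
open import Data.Empty using (⊥; ⊥-elim)
open import Data.Maybe using (just; nothing)
open import Data.Product using (_×_; _,_; Σ; ∃; proj₁; proj₂; map₂)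
open import Data.Sum using (_⊎_; inj₁; inj₂)
import Data.Sum
open import Data.List using (List; []; _∷_; length; lookup; map; upTo; filter)
import Data.List.Properties as List
open import Data.List.Membership.Propositional using (_∈_; _∉_)
open import Data.List.Membership.Propositional.Properties using (∈-upTo⁺; ∈-map⁻; ∈-filter⁺; ∈-filter⁻)
open import Data.List.Relation.Unary.Any using (here; there; _─_; index)
open import Data.List.Relation.Unary.All as All using (All; []; _∷_)
open import Data.List.Relation.Unary.AllPairs as AllPairs using (AllPairs; []; _∷_)
import Data.List.Relation.Unary.AllPairs.Properties as AllPairsₚ
open import Data.List.Relation.Unary.Unique.Propositional using (Unique)
import Data.List.Relation.Unary.Unique.Propositional.Properties as Unique
open import Data.List.Relation.Binary.Subset.Propositional using (_⊆_)
open import Data.Fin using (Fin; toℕ)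
open import Data.Fin.Properties using (toℕ-injective)
open import Function using (_∘_)
open import Relation.Binary.PropositionalEquality
open import Relation.Binary.Definitions using (DecidableEquality; tri<; tri≈; tri>)
open import Relation.Binary.Construct.Closure.ReflexiveTransitive using (ε; _◅_; _◅◅_)
open import Relation.Nullary using (¬_; Dec; yes; no; ¬?)
open import Relation.Nullary.Decidable using (_×-dec_)
open import Relation.Nullary.Reflects using (Reflects; ofʸ; ofⁿ; fromEquivalence; _×-reflects_; _⊎-reflects_)
import Data.Product.Properties as Product
open import Algebra.Properties.CommutativeSemigroup +-commutativeSemigroup using (x∙yz≈y∙xz)

-- Sorted lists of cells

≡ᵇ-reflects-≡ : ∀ m n → Reflects (m ≡ n) (m ≡ᵇ n)
≡ᵇ-reflects-≡ m n = fromEquivalence (≡ᵇ⇒≡ m n) (≡⇒≡ᵇ m n)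

cellEqᵇ-reflects : ∀ x y → Reflects (x ≡ y) (cellEqᵇ x y)
cellEqᵇ-reflects (a , b) (c , d) with a ≡ᵇ c | ≡ᵇ-reflects-≡ a c
... | false | ofⁿ a≢c = ofⁿ (a≢c ∘ cong proj₁)
... | true  | ofʸ refl with b ≡ᵇ d | ≡ᵇ-reflects-≡ b d
...   | false | ofⁿ b≢d = ofⁿ (b≢d ∘ cong proj₂)
...   | true  | ofʸ refl = ofʸ refl

_<ₗ_ : Cell → Cell → Set
(a , b) <ₗ (c , d) = a < c ⊎ (a ≡ c × b < d)

cellLtᵇ-reflects : ∀ x y → Reflects (x <ₗ y) (cellLtᵇ x y)
cellLtᵇ-reflects (a , b) (c , d) =
  <ᵇ-reflects-< a c ⊎-reflects (≡ᵇ-reflects-≡ a c ×-reflects <ᵇ-reflects-< b d)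

<ₗ-irrefl : ∀ x → ¬ x <ₗ x
<ₗ-irrefl (a , b) (inj₁ a<a) = <-irrefl refl a<a
<ₗ-irrefl (a , b) (inj₂ (_ , b<b)) = <-irrefl refl b<b

<ₗ-trans : ∀ x y z → x <ₗ y → y <ₗ z → x <ₗ z
<ₗ-trans _ _ _ (inj₁ p) (inj₁ q) = inj₁ (<-trans p q)
<ₗ-trans _ _ _ (inj₁ p) (inj₂ (refl , _)) = inj₁ p
<ₗ-trans _ _ _ (inj₂ (refl , _)) (inj₁ q) = inj₁ q
<ₗ-trans _ _ _ (inj₂ (refl , p)) (inj₂ (refl , q)) = inj₂ (refl , <-trans p q)

≮ₗ⇒>ₗ : ∀ x y → x ≢ y → ¬ x <ₗ y → y <ₗ x
≮ₗ⇒>ₗ (a , b) (c , d) x≢y x≮y with <-cmp a c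
... | tri< a<c _ _ = ⊥-elim (x≮y (inj₁ a<c))
... | tri> _ _ c<a = inj₁ c<a
... | tri≈ _ refl _ with <-cmp b d
...   | tri< b<d _ _ = ⊥-elim (x≮y (inj₂ (refl , b<d)))
...   | tri≈ _ refl _ = ⊥-elim (x≢y refl)
...   | tri> _ _ d<b = inj₂ (refl , d<b)

Sorted : List Cell → Set
Sorted = AllPairs _<ₗ_

sorted-head-∉ : ∀ {x L} → All (x <ₗ_) L → x ∉ L
sorted-head-∉ x<L x∈L = <ₗ-irrefl _ (All.lookup x<L x∈L)

sorted-≡ : ∀ L M → Sorted L → Sorted M → L ⊆ M → M ⊆ L → L ≡ M
sorted-≡ [] [] _ _ _ _ = refl
sorted-≡ [] (y ∷ M) _ _ _ M⊆L with M⊆L (here refl)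
... | ()
sorted-≡ (x ∷ L) [] _ _ L⊆M _ with L⊆M (here refl)
... | ()
sorted-≡ (x ∷ L) (y ∷ M) (x<L ∷ sL) (y<M ∷ sM) L⊆M M⊆L = cong₂ _∷_ x≡y (sorted-≡ L M sL sM tail⊆ tail⊇)
  where
    x≡y : x ≡ y
    x≡y with L⊆M (here refl) | M⊆L (here refl)
    ... | here x≡y | _ = x≡y
    ... | there _ | here y≡x = sym y≡x
    ... | there x∈M | there y∈L = ⊥-elim (<ₗ-irrefl x (<ₗ-trans x y x (All.lookup x<L y∈L) (All.lookup y<M x∈M)))
    tail⊆ : L ⊆ M
    tail⊆ z∈L with L⊆M (there z∈L)
    ... | there z∈M = z∈M
    ... | here refl = ⊥-elim (sorted-head-∉ (subst (λ v → All (v <ₗ_) L) x≡y x<L) z∈L)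
    tail⊇ : M ⊆ L
    tail⊇ z∈M with M⊆L (there z∈M)
    ... | there z∈L = z∈L
    ... | here refl = ⊥-elim (sorted-head-∉ (subst (λ v → All (v <ₗ_) M) (sym x≡y) y<M) z∈M)

rows-≢ : ∀ {m n c c' : ℕ} → m ≢ n → (m , c) ≢ (n , c')
rows-≢ m≢n refl = m≢n refl

cols-≢ : ∀ {m n c c' : ℕ} → c ≢ c' → (m , c) ≢ (n , c')
cols-≢ c≢c' refl = c≢c' refl

∈-insertCell⁻ : ∀ {z} x L → z ∈ insertCell x L → z ≡ x ⊎ z ∈ L
∈-insertCell⁻ x [] (here z≡x) = inj₁ z≡x
∈-insertCell⁻ x (y ∷ L) z∈ with cellEqᵇ x y | cellLtᵇ x y
... | true | _ = inj₂ z∈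
... | false | true with z∈
...   | here z≡x = inj₁ z≡x
...   | there z∈L = inj₂ z∈L
∈-insertCell⁻ x (y ∷ L) z∈ | false | false with z∈
...   | here z≡y = inj₂ (here z≡y)
...   | there z∈ins with ∈-insertCell⁻ x L z∈ins
...     | inj₁ z≡x = inj₁ z≡x
...     | inj₂ z∈L = inj₂ (there z∈L)

∈-insertCell-self : ∀ x L → x ∈ insertCell x L
∈-insertCell-self x [] = here refl
∈-insertCell-self x (y ∷ L) with cellEqᵇ x y | cellEqᵇ-reflects x y | cellLtᵇ x y
... | true | ofʸ x≡y | _ = here x≡y
... | false | _ | true = here refl
... | false | _ | false = there (∈-insertCell-self x L)

∈-insertCell⁺ : ∀ {z} x L → z ∈ L → z ∈ insertCell x L
∈-insertCell⁺ x (y ∷ L) z∈ with cellEqᵇ x y | cellLtᵇ x y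
... | true | _ = z∈
... | false | true = there z∈
... | false | false with z∈
...   | here z≡y = here z≡y
...   | there z∈L = there (∈-insertCell⁺ x L z∈L)

insertCell-sorted : ∀ x L → Sorted L → Sorted (insertCell x L)
insertCell-sorted x [] [] = [] ∷ []
insertCell-sorted x (y ∷ L) (y<L ∷ sL)
  with cellEqᵇ x y | cellEqᵇ-reflects x y | cellLtᵇ x y | cellLtᵇ-reflects x y
... | true | _ | _ | _ = y<L ∷ sL
... | false | _ | true | ofʸ x<y = (x<y ∷ All.map (<ₗ-trans x y _ x<y) y<L) ∷ y<L ∷ sL
... | false | ofⁿ x≢y | false | ofⁿ x≮y = y<ins ∷ insertCell-sorted x L sL
  where
    y<ins : All (y <ₗ_) (insertCell x L)
    y<ins = All.tabulate λ z∈ → case (∈-insertCell⁻ x L z∈)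
      where
        case : ∀ {z} → z ≡ x ⊎ z ∈ L → y <ₗ z
        case (inj₁ refl) = ≮ₗ⇒>ₗ x y x≢y x≮y
        case (inj₂ z∈L) = All.lookup y<L z∈L

∈-removeCell⁻ : ∀ {z} x L → z ∈ removeCell x L → z ≢ x × z ∈ L
∈-removeCell⁻ x (y ∷ L) z∈ with cellEqᵇ x y | cellEqᵇ-reflects x y
... | true | _ = map₂ there (∈-removeCell⁻ x L z∈)
... | false | ofⁿ x≢y with z∈
...   | here refl = (λ y≡x → x≢y (sym y≡x)) , here refl
...   | there z∈rem = map₂ there (∈-removeCell⁻ x L z∈rem)

∈-removeCell⁺ : ∀ {z} x L → z ≢ x → z ∈ L → z ∈ removeCell x L
∈-removeCell⁺ x (y ∷ L) z≢x z∈ with cellEqᵇ x y | cellEqᵇ-reflects x y | z∈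
... | true | ofʸ refl | here refl = ⊥-elim (z≢x refl)
... | true | _ | there z∈L = ∈-removeCell⁺ x L z≢x z∈L
... | false | _ | here refl = here refl
... | false | _ | there z∈L = there (∈-removeCell⁺ x L z≢x z∈L)

removeCell-sorted : ∀ x L → Sorted L → Sorted (removeCell x L)
removeCell-sorted x L = AllPairsₚ.filter⁺ _

removeCell-∉ : ∀ x L → x ∉ L → removeCell x L ≡ L
removeCell-∉ x [] _ = refl
removeCell-∉ x (y ∷ L) x∉ with cellEqᵇ x y | cellEqᵇ-reflects x y
... | true | ofʸ refl = ⊥-elim (x∉ (here refl))
... | false | _ = cong (y ∷_) (removeCell-∉ x L (x∉ ∘ there))

weight : List Cell → ℕ
weight [] = 0
weight (x ∷ L) = row x + weight L

weight-insertCell-≤ : ∀ x L → weight (insertCell x L) ≤ row x + weight L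
weight-insertCell-≤ x [] = ≤-refl
weight-insertCell-≤ x (y ∷ L) with cellEqᵇ x y | cellLtᵇ x y
... | true | _ = m≤n+m (row y + weight L) (row x)
... | false | true = ≤-refl
... | false | false = begin
  row y + weight (insertCell x L) ≤⟨ +-monoʳ-≤ (row y) (weight-insertCell-≤ x L) ⟩
  row y + (row x + weight L)     ≡⟨ x∙yz≈y∙xz (row y) (row x) (weight L) ⟩
  row x + (row y + weight L)     ∎
  where open ≤-Reasoning

weight-insertCell-∉ : ∀ x L → x ∉ L → weight (insertCell x L) ≡ row x + weight L
weight-insertCell-∉ x [] _ = refl
weight-insertCell-∉ x (y ∷ L) x∉ with cellEqᵇ x y | cellEqᵇ-reflects x y | cellLtᵇ x y
... | true | ofʸ refl | _ = ⊥-elim (x∉ (here refl))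
... | false | _ | true = refl
... | false | _ | false = begin
  row y + weight (insertCell x L) ≡⟨ cong (row y +_) (weight-insertCell-∉ x L (x∉ ∘ there)) ⟩
  row y + (row x + weight L)     ≡⟨ x∙yz≈y∙xz (row y) (row x) (weight L) ⟩
  row x + (row y + weight L)     ∎
  where open ≡-Reasoning

weight-removeCell-≤ : ∀ x L → weight (removeCell x L) ≤ weight L
weight-removeCell-≤ x [] = ≤-refl
weight-removeCell-≤ x (y ∷ L) with cellEqᵇ x y
... | true = ≤-trans (weight-removeCell-≤ x L) (m≤n+m _ _)
... | false = +-monoʳ-≤ (row y) (weight-removeCell-≤ x L)

weight-removeCell-∈ : ∀ x L → x ∈ L → weight (removeCell x L) + row x ≤ weight L
weight-removeCell-∈ x (y ∷ L) x∈ with cellEqᵇ x y | cellEqᵇ-reflects x y | x∈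
... | true | _ | here refl = begin
  weight (removeCell x L) + row x ≤⟨ +-monoˡ-≤ (row x) (weight-removeCell-≤ x L) ⟩
  weight L + row x               ≡⟨ +-comm (weight L) (row x) ⟩
  row x + weight L               ∎
  where open ≤-Reasoning
... | true | _ | there x∈L = ≤-trans (weight-removeCell-∈ x L x∈L) (m≤n+m _ _)
... | false | ofⁿ x≢y | here refl = ⊥-elim (x≢y refl)
... | false | _ | there x∈L = begin
  row y + weight (removeCell x L) + row x   ≡⟨ +-assoc (row y) _ (row x) ⟩
  row y + (weight (removeCell x L) + row x) ≤⟨ +-monoʳ-≤ (row y) (weight-removeCell-∈ x L x∈L) ⟩
  row y + weight L                          ∎
  where open ≤-Reasoning

weight-removeCell-sorted : ∀ x L → Sorted L → x ∈ L → weight (removeCell x L) + row x ≡ weight L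
weight-removeCell-sorted x (y ∷ L) (y<L ∷ sL) x∈ with cellEqᵇ x y | cellEqᵇ-reflects x y | x∈
... | true | _ | here refl = begin
  weight (removeCell x L) + row x ≡⟨ cong (λ M → weight M + row x) (removeCell-∉ x L (sorted-head-∉ y<L)) ⟩
  weight L + row x               ≡⟨ +-comm (weight L) (row x) ⟩
  row x + weight L               ∎
  where open ≡-Reasoning
... | true | ofʸ refl | there x∈L = ⊥-elim (sorted-head-∉ y<L x∈L)
... | false | ofⁿ x≢y | here refl = ⊥-elim (x≢y refl)
... | false | _ | there x∈L =
  trans (+-assoc (row y) _ (row x)) (cong (row y +_) (weight-removeCell-sorted x L sL x∈L))

relocate : Cell → Cell → List Cell → List Cell
relocate a a' L = insertCell a' (removeCell a L)

∈-relocate⁻ : ∀ {z} a a' L → z ∈ relocate a a' L → z ≡ a' ⊎ (z ≢ a × z ∈ L)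
∈-relocate⁻ a a' L z∈ = Data.Sum.map₂ (∈-removeCell⁻ a L) (∈-insertCell⁻ a' (removeCell a L) z∈)

∈-relocate⁺ : ∀ {z} a a' L → z ∈ L → z ≢ a → z ∈ relocate a a' L
∈-relocate⁺ a a' L z∈L z≢a = ∈-insertCell⁺ a' (removeCell a L) (∈-removeCell⁺ a L z≢a z∈L)

∈-relocate-target : ∀ a a' L → a' ∈ relocate a a' L
∈-relocate-target a a' L = ∈-insertCell-self a' (removeCell a L)

∉-relocate : ∀ {z} a a' L → z ≢ a' → z ∉ L → z ∉ relocate a a' L
∉-relocate a a' L z≢a' z∉L z∈ with ∈-relocate⁻ a a' L z∈
... | inj₁ z≡a' = z≢a' z≡a'
... | inj₂ (_ , z∈L) = z∉L z∈L

relocate-source-∉ : ∀ a a' L → a ≢ a' → a ∉ relocate a a' L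
relocate-source-∉ a a' L a≢a' a∈ with ∈-relocate⁻ a a' L a∈
... | inj₁ a≡a' = a≢a' a≡a'
... | inj₂ (a≢a , _) = a≢a refl

relocate-sorted : ∀ a a' L → Sorted L → Sorted (relocate a a' L)
relocate-sorted a a' L sL = insertCell-sorted a' (removeCell a L) (removeCell-sorted a L sL)

relocate-comm-⊆ : ∀ a a' b b' L → a' ≢ b → relocate a a' (relocate b b' L) ⊆ relocate b b' (relocate a a' L)
relocate-comm-⊆ a a' b b' L a'≢b z∈ with ∈-relocate⁻ a a' (relocate b b' L) z∈
... | inj₁ refl = ∈-relocate⁺ b b' (relocate a a' L) (∈-relocate-target a a' L) a'≢b
... | inj₂ (z≢a , z∈) with ∈-relocate⁻ b b' L z∈
...   | inj₁ refl = ∈-relocate-target b b' (relocate a a' L)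
...   | inj₂ (z≢b , z∈L) = ∈-relocate⁺ b b' (relocate a a' L) (∈-relocate⁺ a a' L z∈L z≢a) z≢b

relocate-comm : ∀ a a' b b' L → Sorted L → a' ≢ b → b' ≢ a →
                relocate a a' (relocate b b' L) ≡ relocate b b' (relocate a a' L)
relocate-comm a a' b b' L sL a'≢b b'≢a = sorted-≡ _ _
  (relocate-sorted a a' (relocate b b' L) (relocate-sorted b b' L sL))
  (relocate-sorted b b' (relocate a a' L) (relocate-sorted a a' L sL))
  (relocate-comm-⊆ a a' b b' L a'≢b) (relocate-comm-⊆ b b' a a' L b'≢a)

-- Kohnert moves

maxCol-∈ : ∀ r L {m} → maxCol r L ≡ just m → (r , m) ∈ L
maxCol-∈ r ((a , b) ∷ L) eq with maxCol r L in eqL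
... | nothing with a ≡ᵇ r | ≡ᵇ-reflects-≡ a r | eq
...   | true | ofʸ refl | refl = here refl
maxCol-∈ r ((a , b) ∷ L) eq | just m with a ≡ᵇ r | ≡ᵇ-reflects-≡ a r | eq
...   | true | ofʸ refl | refl with ⊔-sel b m
...     | inj₁ b⊔m≡b rewrite b⊔m≡b = here refl
...     | inj₂ b⊔m≡m rewrite b⊔m≡m = there (maxCol-∈ r L eqL)
maxCol-∈ r ((a , b) ∷ L) eq | just m | false | _ | refl = there (maxCol-∈ r L eqL)

maxCol-nothing : ∀ r L → maxCol r L ≡ nothing → ∀ c → (r , c) ∉ L
maxCol-nothing r ((a , b) ∷ L) eq c c∈ with maxCol r L in eqL
... | just _ with a ≡ᵇ r | eq
...   | true | ()
...   | false | ()
maxCol-nothing r ((a , b) ∷ L) eq c c∈ | nothing with a ≡ᵇ r | ≡ᵇ-reflects-≡ a r | eq | c∈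
...   | false | ofⁿ a≢r | _ | here refl = a≢r refl
...   | false | _ | _ | there c∈L = maxCol-nothing r L eqL c c∈L

maxCol-≥ : ∀ r L {m c} → maxCol r L ≡ just m → (r , c) ∈ L → c ≤ m
maxCol-≥ r ((a , b) ∷ L) {c = c} eq c∈ with maxCol r L in eqL
... | nothing with a ≡ᵇ r | ≡ᵇ-reflects-≡ a r | eq | c∈
...   | true | _ | refl | here refl = ≤-refl
...   | true | _ | refl | there c∈L = ⊥-elim (maxCol-nothing r L eqL c c∈L)
maxCol-≥ r ((a , b) ∷ L) {c = c} eq c∈ | just m with a ≡ᵇ r | ≡ᵇ-reflects-≡ a r | eq | c∈
...   | true | _ | refl | here refl = m≤m⊔n c m
...   | true | _ | refl | there c∈L = ≤-trans (maxCol-≥ r L eqL c∈L) (m≤n⊔m b m)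
...   | false | ofⁿ a≢r | refl | here refl = ⊥-elim (a≢r refl)
...   | false | _ | refl | there c∈L = maxCol-≥ r L eqL c∈L

maxCol-rightmost : ∀ r L c → (r , c) ∈ L → (∀ c' → c < c' → (r , c') ∉ L) → maxCol r L ≡ just c
maxCol-rightmost r L c c∈ nothing-right with maxCol r L in eq
... | nothing = ⊥-elim (maxCol-nothing r L eq c c∈)
... | just m with <-cmp c m
...   | tri< c<m _ _ = ⊥-elim (nothing-right m c<m (maxCol-∈ r L eq))
...   | tri≈ _ refl _ = refl
...   | tri> _ _ m<c = ⊥-elim (<⇒≱ m<c (maxCol-≥ r L eq c∈))

memᵇ-reflects : ∀ x L → Reflects (x ∈ L) (memᵇ x L)
memᵇ-reflects x [] = ofⁿ λ ()
memᵇ-reflects x (y ∷ L) with cellEqᵇ x y | cellEqᵇ-reflects x y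
... | true | ofʸ x≡y = ofʸ (here x≡y)
... | false | ofⁿ x≢y with memᵇ x L | memᵇ-reflects x L
...   | true | ofʸ x∈L = ofʸ (there x∈L)
...   | false | ofⁿ x∉L = ofⁿ λ { (here x≡y) → x≢y x≡y ; (there x∈L) → x∉L x∈L }

findFree-≤ : ∀ k c D {r'} → findFree k c D ≡ just r' → r' ≤ k
findFree-≤ (suc k) c D eq with memᵇ (suc k , c) D | eq
... | true | eq′ = m≤n⇒m≤1+n (findFree-≤ k c D eq′)
... | false | refl = ≤-refl

findFree-< : ∀ r c D {r'} → findFree (r ∸ 1) c D ≡ just r' → r' < r
findFree-< (suc k) c D eq = s≤s (findFree-≤ k c D eq)

findFree-∉ : ∀ k c D {r'} → findFree k c D ≡ just r' → (r' , c) ∉ D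
findFree-∉ (suc k) c D eq with memᵇ (suc k , c) D | memᵇ-reflects (suc k , c) D | eq
... | true | _ | eq′ = findFree-∉ k c D eq′
... | false | ofⁿ free | refl = free

findFree-top : ∀ k c D → (suc k , c) ∉ D → findFree (suc k) c D ≡ just (suc k)
findFree-top k c D free with memᵇ (suc k , c) D | memᵇ-reflects (suc k , c) D
... | true | ofʸ occupied = ⊥-elim (free occupied)
... | false | _ = refl

data KohnertView (r : ℕ) (D : Diagram) : Diagram → Set where
  unchanged : KohnertView r D D
  moved : ∀ c r' → maxCol r D ≡ just c → findFree (r ∸ 1) c D ≡ just r' →
          KohnertView r D (relocate (r , c) (r' , c) D)

kohnertView : ∀ r D → KohnertView r D (kohnert r D)
kohnertView r D with maxCol r D in eqc
... | nothing = unchanged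
... | just c with findFree (r ∸ 1) c D in eqr
...   | nothing = unchanged
...   | just r' = moved c r' eqc eqr

kohnert-moves : ∀ r D {c r'} → maxCol r D ≡ just c → findFree (r ∸ 1) c D ≡ just r' →
                kohnert r D ≡ relocate (r , c) (r' , c) D
kohnert-moves r D eqc eqr rewrite eqc | eqr = refl

kohnert-sorted : ∀ r D → Sorted D → Sorted (kohnert r D)
kohnert-sorted r D sD with kohnert r D | kohnertView r D
... | _ | unchanged = sD
... | _ | moved c r' _ _ = relocate-sorted (r , c) (r' , c) D sD

kohnert-weight : ∀ r D → kohnert r D ≡ D ⊎ weight (kohnert r D) < weight D
kohnert-weight r D with kohnert r D | kohnertView r D
... | _ | unchanged = inj₁ refl
... | _ | moved c r' eqc eqr = inj₂ (begin-strict
  weight (relocate (r , c) (r' , c) D)                ≤⟨ weight-insertCell-≤ (r' , c) (removeCell (r , c) D) ⟩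
  r' + weight (removeCell (r , c) D)                  <⟨ +-monoˡ-< _ (findFree-< r c D eqr) ⟩
  r + weight (removeCell (r , c) D)                   ≡⟨ +-comm r _ ⟩
  weight (removeCell (r , c) D) + r                   ≤⟨ weight-removeCell-∈ (r , c) D (maxCol-∈ r D eqc) ⟩
  weight D                                            ∎)
  where open ≤-Reasoning

-- The Kohnert poset

canon-sorted : ∀ L → Sorted (canon L)
canon-sorted [] = []
canon-sorted (x ∷ L) = insertCell-sorted x (canon L) (canon-sorted L)

⪯-sorted : ∀ {A B} → B ⪯ A → Sorted A → Sorted B
⪯-sorted ε sA = sA
⪯-sorted ((r , refl) ◅ B⪯) sA = ⪯-sorted B⪯ (kohnert-sorted r _ sA)

⪯-trans : ∀ {x y z} → x ⪯ y → y ⪯ z → x ⪯ z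
⪯-trans x⪯y y⪯z = y⪯z ◅◅ x⪯y

⪯⇒≡⊎weight< : ∀ {A B} → B ⪯ A → A ≡ B ⊎ weight B < weight A
⪯⇒≡⊎weight< ε = inj₁ refl
⪯⇒≡⊎weight< {A} ((r , refl) ◅ B⪯) with kohnert-weight r A | ⪯⇒≡⊎weight< B⪯
... | inj₁ step≡ | inj₁ rest≡ = inj₁ (trans (sym step≡) rest≡)
... | inj₁ step≡ | inj₂ rest< = inj₂ (subst (λ E → _ < weight E) step≡ rest<)
... | inj₂ step< | inj₁ refl = inj₂ step<
... | inj₂ step< | inj₂ rest< = inj₂ (<-trans rest< step<)

⪯⇒weight≤ : ∀ {A B} → B ⪯ A → weight B ≤ weight A
⪯⇒weight≤ B⪯A with ⪯⇒≡⊎weight< B⪯A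
... | inj₁ refl = ≤-refl
... | inj₂ lt = <⇒≤ lt

weight<⇒≢ : ∀ {x y} → weight y < weight x → x ≢ y
weight<⇒≢ lt refl = <-irrefl refl lt

_≺_ : Diagram → Diagram → Set
y ≺ x = y ⪯ x × weight y < weight x

≺-trans : ∀ {x y z} → x ≺ y → y ≺ z → x ≺ z
≺-trans (x⪯y , x<y) (y⪯z , y<z) = ⪯-trans x⪯y y⪯z , <-trans x<y y<z

_⋖_ : Diagram → Diagram → Set
M ⋖ L = M ⪯ L × weight L ≡ suc (weight M)

_≟ᶜ_ : DecidableEquality Cell
_≟ᶜ_ = Product.≡-dec _≟_ _≟_

_≟ᴰ_ : DecidableEquality Diagram
_≟ᴰ_ = List.≡-dec _≟ᶜ_

open import Data.List.Membership.DecPropositional _≟ᴰ_ using (_∈?_)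

Comparable : Diagram → Diagram → Set
Comparable x y = x ⪯ y ⊎ y ⪯ x

comparable-sym : ∀ {x y} → Comparable x y → Comparable y x
comparable-sym (inj₁ x⪯y) = inj₂ x⪯y
comparable-sym (inj₂ y⪯x) = inj₁ y⪯x

comparable-weight-≡ : ∀ {x y} → Comparable x y → weight x ≡ weight y → x ≡ y
comparable-weight-≡ (inj₁ x⪯y) w≡ with ⪯⇒≡⊎weight< x⪯y
... | inj₁ y≡x = sym y≡x
... | inj₂ lt = ⊥-elim (<-irrefl w≡ lt)
comparable-weight-≡ (inj₂ y⪯x) w≡ with ⪯⇒≡⊎weight< y⪯x
... | inj₁ x≡y = x≡y
... | inj₂ lt = ⊥-elim (<-irrefl (sym w≡) lt)

-- Chains

∈-─ : ∀ {A : Set} {x z : A} {ys} (x∈ys : x ∈ ys) → z ∈ ys → z ≢ x → z ∈ (ys ─ x∈ys)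
∈-─ (here refl) (here refl) z≢x = ⊥-elim (z≢x refl)
∈-─ (here _) (there z∈ys) _ = z∈ys
∈-─ (there _) (here refl) _ = here refl
∈-─ (there x∈ys) (there z∈ys) z≢x = there (∈-─ x∈ys z∈ys z≢x)

Unique-length-≤ : ∀ {A : Set} {xs ys : List A} → Unique xs → xs ⊆ ys → length xs ≤ length ys
Unique-length-≤ {xs = []} _ _ = z≤n
Unique-length-≤ {xs = x ∷ xs} {ys} (x∉xs ∷ u) xs⊆ys = begin
  suc (length xs)           ≤⟨ s≤s (Unique-length-≤ u xs⊆ys─x) ⟩
  suc (length (ys ─ x∈ys)) ≡⟨ sym (List.length-removeAt′ ys (index x∈ys)) ⟩
  length ys                 ∎
  where
    open ≤-Reasoning
    x∈ys : x ∈ ys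
    x∈ys = xs⊆ys (here refl)
    xs⊆ys─x : xs ⊆ (ys ─ x∈ys)
    xs⊆ys─x z∈xs = ∈-─ x∈ys (xs⊆ys (there z∈xs)) (λ { refl → All.lookup x∉xs z∈xs refl })

Unique-length-≡ : ∀ {A : Set} {xs ys : List A} → Unique xs → Unique ys → xs ⊆ ys → ys ⊆ xs →
                  length xs ≡ length ys
Unique-length-≡ uxs uys xs⊆ys ys⊆xs = ≤-antisym (Unique-length-≤ uxs xs⊆ys) (Unique-length-≤ uys ys⊆xs)

chain-weights-distinct : ∀ {C} → Unique C → (∀ {x y} → x ∈ C → y ∈ C → Comparable x y) →
                         AllPairs (λ x y → weight x ≢ weight y) C
chain-weights-distinct [] _ = []
chain-weights-distinct (x∉C ∷ u) cmp =
  All.tabulate (λ y∈C w≡ → All.lookup x∉C y∈C (comparable-weight-≡ (cmp (here refl) (there y∈C)) w≡))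
  ∷ chain-weights-distinct u (λ p q → cmp (there p) (there q))

chain-length-≤ : ∀ D C → IsChain D C → length C ≤ suc (weight (canon D))
chain-length-≤ D C (inP , u , cmp) = begin
  length C                            ≡⟨ sym (List.length-map weight C) ⟩
  length (map weight C)               ≤⟨ Unique-length-≤ (AllPairsₚ.map⁺ (chain-weights-distinct u cmp)) bounded ⟩
  length (upTo (suc (weight (canon D)))) ≡⟨ List.length-upTo _ ⟩
  suc (weight (canon D))              ∎
  where
    open ≤-Reasoning
    bounded : map weight C ⊆ upTo (suc (weight (canon D)))
    bounded n∈ with ∈-map⁻ weight n∈
    ... | (x , x∈C , refl) = ∈-upTo⁺ (s≤s (⪯⇒weight≤ (All.lookup inP x∈C)))

chain-∷ : ∀ {D C z} → IsChain D C → InP D z → z ∉ C → (∀ {u} → u ∈ C → Comparable z u) →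
          IsChain D (z ∷ C)
chain-∷ {C = C} {z} (inP , u , cmp) z∈P z∉C z~C = (z∈P ∷ inP) , (All.tabulate z≢ ∷ u) , cmp′
  where
    z≢ : ∀ {y} → y ∈ C → z ≢ y
    z≢ y∈C refl = z∉C y∈C
    cmp′ : ∀ {x y} → x ∈ z ∷ C → y ∈ z ∷ C → Comparable x y
    cmp′ (here refl) (here refl) = inj₁ ε
    cmp′ (here refl) (there y∈C) = z~C y∈C
    cmp′ (there x∈C) (here refl) = comparable-sym (z~C x∈C)
    cmp′ (there x∈C) (there y∈C) = cmp x∈C y∈C

maxChain-absorbs : ∀ {D M z} → IsMaxChain D M → InP D z → (∀ {u} → u ∈ M → Comparable z u) → z ∈ M
maxChain-absorbs {D} {M} {z} (chM , maxM) z∈P z~M with z ∈? M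
... | yes z∈M = z∈M
... | no z∉M = maxM (z ∷ M) (chain-∷ {D} chM z∈P z∉M z~M) there (here refl)

-- Maximality of a chain is not decidable, so the extension is only
-- obtained under double negation; the fuel n runs out before the chain
-- can outgrow the bound of chain-length-≤.
¬¬maxChain-⊇-fuel : ∀ D n C → IsChain D C → suc (weight (canon D)) < length C + n →
                    ¬ ¬ (∃ λ M → IsMaxChain D M × C ⊆ M)
¬¬maxChain-⊇-fuel D zero C chC bound _ =
  <⇒≱ (subst (suc (weight (canon D)) <_) (+-identityʳ (length C)) bound) (chain-length-≤ D C chC)
¬¬maxChain-⊇-fuel D (suc n) C chC bound noMax = noMax (C , (chC , maximal) , λ x∈C → x∈C)
  where
    maximal : ∀ G → IsChain D G → C ⊆ G → G ⊆ C
    maximal G (inG , _ , cmpG) C⊆G {x} x∈G with x ∈? C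
    ... | yes x∈C = x∈C
    ... | no x∉C = ⊥-elim (¬¬maxChain-⊇-fuel D n (x ∷ C) chxC
                     (subst (suc (weight (canon D)) <_) (+-suc (length C) n) bound)
                     λ { (M , maxM , xC⊆M) → noMax (M , maxM , xC⊆M ∘ there) })
      where
        chxC : IsChain D (x ∷ C)
        chxC = chain-∷ {D} chC (All.lookup inG x∈G) x∉C (λ u∈C → cmpG x∈G (C⊆G u∈C))

¬¬maxChain-⊇ : ∀ D C → IsChain D C → ¬ ¬ (∃ λ M → IsMaxChain D M × C ⊆ M)
¬¬maxChain-⊇ D C chC =
  ¬¬maxChain-⊇-fuel D (suc (suc (weight (canon D)))) C chC (m≤n+m (suc (suc (weight (canon D)))) (length C))

descending⇒chain : ∀ {D C} → All (InP D) C → AllPairs (λ x y → y ≺ x) C → IsChain D C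
descending⇒chain inP desc = inP , AllPairs.map (λ y≺x → weight<⇒≢ (proj₂ y≺x)) desc , comparable desc
  where
    comparable : ∀ {C} → AllPairs (λ x y → y ≺ x) C → ∀ {x y} → x ∈ C → y ∈ C → Comparable x y
    comparable (_ ∷ _) (here refl) (here refl) = inj₁ ε
    comparable (x≻ ∷ _) (here refl) (there y∈) = inj₂ (proj₁ (All.lookup x≻ y∈))
    comparable (x≻ ∷ _) (there x∈) (here refl) = inj₁ (proj₁ (All.lookup x≻ x∈))
    comparable (_ ∷ desc) (there x∈) (there y∈) = comparable desc x∈ y∈

chain-weight-injective : ∀ {D C x y} → IsChain D C → x ∈ C → y ∈ C → weight x ≡ weight y → x ≡ y
chain-weight-injective (_ , _ , cmp) x∈C y∈C = comparable-weight-≡ (cmp x∈C y∈C)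

-- Thin chains and shellability

-- The uniqueness fields make the chain rigid: strictly between B and T, the
-- only elements comparable with U₁ or U₂ are U₁ and U₂ (comparable-middle).
record ThinChain (T B U₁ U₂ : Diagram) : Set where
  field
    U₁⋖T : U₁ ⋖ T
    U₂⋖U₁ : U₂ ⋖ U₁
    B⋖U₂ : B ⋖ U₂
    U₂-unique : ∀ z → B ⪯ z → z ⪯ U₁ → weight z ≡ weight U₂ → z ≡ U₂
    U₁-unique : ∀ z → U₂ ⪯ z → z ⪯ T → weight z ≡ weight U₁ → z ≡ U₁

module Interval (T B : Diagram) where

  Outside : Diagram → Set
  Outside z = T ⪯ z ⊎ z ⪯ B

  outside-or-inside : ∀ {z} → Comparable z T → Comparable z B →
                      Outside z ⊎ (z ⪯ T × B ⪯ z × weight B < weight z × weight z < weight T)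
  outside-or-inside (inj₂ T⪯z) _ = inj₁ (inj₁ T⪯z)
  outside-or-inside (inj₁ z⪯T) (inj₁ z⪯B) = inj₁ (inj₂ z⪯B)
  outside-or-inside (inj₁ z⪯T) (inj₂ B⪯z) with ⪯⇒≡⊎weight< z⪯T | ⪯⇒≡⊎weight< B⪯z
  ... | inj₁ refl | _ = inj₁ (inj₁ ε)
  ... | inj₂ _ | inj₁ refl = inj₁ (inj₂ ε)
  ... | inj₂ z<T | inj₂ B<z = inj₂ (z⪯T , B⪯z , B<z , z<T)

  module _ {U₁ U₂ : Diagram} (thin : ThinChain T B U₁ U₂) where
    open ThinChain thin

    U₁⪯T : U₁ ⪯ T
    U₁⪯T = proj₁ U₁⋖T
    U₂⪯U₁ : U₂ ⪯ U₁
    U₂⪯U₁ = proj₁ U₂⋖U₁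
    B⪯U₂ : B ⪯ U₂
    B⪯U₂ = proj₁ B⋖U₂
    weight-T : weight T ≡ suc (weight U₁)
    weight-T = proj₂ U₁⋖T
    weight-U₁ : weight U₁ ≡ suc (weight U₂)
    weight-U₁ = proj₂ U₂⋖U₁
    weight-U₂ : weight U₂ ≡ suc (weight B)
    weight-U₂ = proj₂ B⋖U₂

    U₁<T : weight U₁ < weight T
    U₁<T = ≤-reflexive (sym weight-T)
    U₂<U₁ : weight U₂ < weight U₁
    U₂<U₁ = ≤-reflexive (sym weight-U₁)
    B<U₂ : weight B < weight U₂
    B<U₂ = ≤-reflexive (sym weight-U₂)

    comparable-middle : ∀ {U z} → U ∈ U₁ ∷ U₂ ∷ [] → Comparable z T → Comparable z B → Comparable z U →
                        Outside z ⊎ (z ≡ U₁ ⊎ z ≡ U₂)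
    comparable-middle {U} {z} U∈ z~T z~B z~U with outside-or-inside z~T z~B
    ... | inj₁ out = inj₁ out
    ... | inj₂ (z⪯T , B⪯z , B<z , z<T) with z ≟ᴰ U₁ | z ≟ᴰ U₂
    ...   | yes z≡U₁ | _ = inj₂ (inj₁ z≡U₁)
    ...   | no _ | yes z≡U₂ = inj₂ (inj₂ z≡U₂)
    ...   | no z≢U₁ | no z≢U₂ = ⊥-elim (between U∈ z~U)
      where
        below-U₁ : z ⪯ U₁ → ⊥
        below-U₁ z⪯U₁ with ⪯⇒≡⊎weight< z⪯U₁
        ... | inj₁ U₁≡z = z≢U₁ (sym U₁≡z)
        ... | inj₂ z<U₁ = z≢U₂ (U₂-unique z B⪯z z⪯U₁
                (≤-antisym (≤-pred (subst (weight z <_) weight-U₁ z<U₁)) (subst (_≤ weight z) (sym weight-U₂) B<z)))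
        above-U₂ : U₂ ⪯ z → ⊥
        above-U₂ U₂⪯z with ⪯⇒≡⊎weight< U₂⪯z
        ... | inj₁ z≡U₂ = z≢U₂ z≡U₂
        ... | inj₂ U₂<z = z≢U₁ (U₁-unique z U₂⪯z z⪯T
                (≤-antisym (≤-pred (subst (weight z <_) weight-T z<T)) (subst (_≤ weight z) (sym weight-U₁) U₂<z)))
        between : U ∈ U₁ ∷ U₂ ∷ [] → Comparable z U → ⊥
        between (here refl) (inj₁ z⪯U₁) = below-U₁ z⪯U₁
        between (here refl) (inj₂ U₁⪯z) = above-U₂ (⪯-trans U₂⪯U₁ U₁⪯z)
        between (there (here refl)) (inj₁ z⪯U₂) = below-U₁ (⪯-trans z⪯U₂ U₂⪯U₁)
        between (there (here refl)) (inj₂ U₂⪯z) = above-U₂ U₂⪯z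

    outside-comparable-U₁ : ∀ {z} → Outside z → Comparable z U₁
    outside-comparable-U₁ (inj₁ T⪯z) = inj₂ (⪯-trans U₁⪯T T⪯z)
    outside-comparable-U₁ (inj₂ z⪯B) = inj₁ (⪯-trans z⪯B (⪯-trans B⪯U₂ U₂⪯U₁))

    outside-comparable-U₂ : ∀ {z} → Outside z → Comparable z U₂
    outside-comparable-U₂ (inj₁ T⪯z) = inj₂ (⪯-trans (⪯-trans U₂⪯U₁ U₁⪯T) T⪯z)
    outside-comparable-U₂ (inj₂ z⪯B) = inj₁ (⪯-trans z⪯B B⪯U₂)

    outside-≢U₁ : ∀ {z} → Outside z → z ≢ U₁
    outside-≢U₁ (inj₁ T⪯z) refl = <-irrefl refl (<-≤-trans U₁<T (⪯⇒weight≤ T⪯z))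
    outside-≢U₁ (inj₂ z⪯B) refl = <-irrefl refl (≤-<-trans (⪯⇒weight≤ z⪯B) (<-trans B<U₂ U₂<U₁))

    outside-≢U₂ : ∀ {z} → Outside z → z ≢ U₂
    outside-≢U₂ (inj₁ T⪯z) refl = <-irrefl refl (<-≤-trans (<-trans U₂<U₁ U₁<T) (⪯⇒weight≤ T⪯z))
    outside-≢U₂ (inj₂ z⪯B) refl = <-irrefl refl (≤-<-trans (⪯⇒weight≤ z⪯B) B<U₂)

    U₁≢U₂ : U₁ ≢ U₂
    U₁≢U₂ = weight<⇒≢ U₂<U₁

    thin-chain : ∀ {D} → InP D T → IsChain D (T ∷ U₁ ∷ U₂ ∷ B ∷ [])
    thin-chain {D} T∈P = descending⇒chain {D}
      (T∈P ∷ U₁∈P ∷ U₂∈P ∷ ⪯-trans B⪯U₂ U₂∈P ∷ [])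
      ((U₁≺T ∷ U₂≺T ∷ B≺T ∷ []) ∷ (U₂≺U₁ ∷ B≺U₁ ∷ []) ∷ (B≺U₂ ∷ []) ∷ [] ∷ [])
      where
        U₁∈P : InP D U₁
        U₁∈P = ⪯-trans U₁⪯T T∈P
        U₂∈P : InP D U₂
        U₂∈P = ⪯-trans U₂⪯U₁ U₁∈P
        U₁≺T : U₁ ≺ T
        U₁≺T = U₁⪯T , U₁<T
        U₂≺U₁ : U₂ ≺ U₁
        U₂≺U₁ = U₂⪯U₁ , U₂<U₁
        B≺U₂ : B ≺ U₂
        B≺U₂ = B⪯U₂ , B<U₂
        U₂≺T : U₂ ≺ T
        U₂≺T = ≺-trans U₂≺U₁ U₁≺T
        B≺U₁ : B ≺ U₁
        B≺U₁ = ≺-trans B≺U₂ U₂≺U₁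
        B≺T : B ≺ T
        B≺T = ≺-trans B≺U₁ U₁≺T

module Shelling {D : List Cell} (Fs : List (List Diagram))
  (facet : ∀ i → IsMaxChain D (lookup Fs i))
  (complete : ∀ M → IsMaxChain D M → Σ (Fin (length Fs)) λ i → M ⊆ lookup Fs i × lookup Fs i ⊆ M)
  (facets-distinct : ∀ i j → lookup Fs i ⊆ lookup Fs j → lookup Fs j ⊆ lookup Fs i → i ≡ j)
  (pure : ∀ k → 1 ≤ toℕ k → PureCondition Fs k)
  (T B : Diagram)
  where

  open Interval T B

  record Split (F : List Diagram) (U₁ U₂ : Diagram) (Q : List Diagram) : Set where
    field
      thin : ThinChain T B U₁ U₂
      maximal : IsMaxChain D F
      split⊆ : F ⊆ U₁ ∷ U₂ ∷ Q
      ⊆split : U₁ ∷ U₂ ∷ Q ⊆ F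
      U₁∉Q : U₁ ∉ Q
      U₂∉Q : U₂ ∉ Q
      Q-unique : Unique Q
      T∈Q : T ∈ Q
      B∈Q : B ∈ Q

  module SplitProperties {F U₁ U₂ Q} (S : Split F U₁ U₂ Q) where
    open Split S

    Q⊆F : Q ⊆ F
    Q⊆F = ⊆split ∘ there ∘ there

    F-chain : IsChain D F
    F-chain = proj₁ maximal

    F-comparable : ∀ {x y} → x ∈ F → y ∈ F → Comparable x y
    F-comparable = proj₂ (proj₂ F-chain)

    ∈F⇒∈P : ∀ {x} → x ∈ F → InP D x
    ∈F⇒∈P = All.lookup (proj₁ F-chain)

    outside-∈Q : ∀ {z} → InP D z → Outside z → (∀ {q} → q ∈ Q → Comparable z q) → z ∈ Q
    outside-∈Q {z} z∈P out z~Q with split⊆ (maxChain-absorbs {D} maximal z∈P z~F)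
      where
        z~F : ∀ {u} → u ∈ F → Comparable z u
        z~F u∈F with split⊆ u∈F
        ... | here refl = outside-comparable-U₁ thin out
        ... | there (here refl) = outside-comparable-U₂ thin out
        ... | there (there u∈Q) = z~Q u∈Q
    ... | here z≡U₁ = ⊥-elim (outside-≢U₁ thin out z≡U₁)
    ... | there (here z≡U₂) = ⊥-elim (outside-≢U₂ thin out z≡U₂)
    ... | there (there z∈Q) = z∈Q

    Q-outside : ∀ {q} → q ∈ Q → Outside q
    Q-outside {q} q∈Q
      with comparable-middle thin (here refl) (compare (Q⊆F T∈Q)) (compare (Q⊆F B∈Q)) (compare (⊆split (here refl)))
      where
        compare : ∀ {u} → u ∈ F → Comparable q u
        compare = F-comparable (Q⊆F q∈Q)
    ... | inj₁ out = out
    ... | inj₂ (inj₁ refl) = ⊥-elim (U₁∉Q q∈Q)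
    ... | inj₂ (inj₂ refl) = ⊥-elim (U₂∉Q q∈Q)

    maxChain-through-⊆ : ∀ {G U} → IsMaxChain D G → Q ⊆ G → U ∈ U₁ ∷ U₂ ∷ [] → U ∈ G → G ⊆ F
    maxChain-through-⊆ ((inG , _ , cmpG) , _) Q⊆G U∈ U∈G {y} y∈G
      with comparable-middle thin U∈ (cmpG y∈G (Q⊆G T∈Q)) (cmpG y∈G (Q⊆G B∈Q)) (cmpG y∈G U∈G)
    ... | inj₁ out = Q⊆F (outside-∈Q (All.lookup inG y∈G) out (λ q∈Q → cmpG y∈G (Q⊆G q∈Q)))
    ... | inj₂ (inj₁ refl) = ⊆split (here refl)
    ... | inj₂ (inj₂ refl) = ⊆split (there (here refl))

    length-split : length F ≡ suc (suc (length Q))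
    length-split = Unique-length-≡ (proj₁ (proj₂ F-chain)) unique-split split⊆ ⊆split
      where
        unique-split : Unique (U₁ ∷ U₂ ∷ Q)
        unique-split = (U₁≢U₂ thin ∷ All.tabulate (λ q∈Q → λ { refl → U₁∉Q q∈Q }))
                     ∷ All.tabulate (λ q∈Q → λ { refl → U₂∉Q q∈Q }) ∷ Q-unique

  open Split
  open SplitProperties

  -- Q is maximal in the intersection of F_k with the earlier facets, yet it
  -- misses two vertices of F_k.
  split-later-facet-impure : ∀ {k j U₁ U₂ Q} → Split (lookup Fs k) U₁ U₂ Q →
                             toℕ j < toℕ k → Q ⊆ lookup Fs j → ⊥
  split-later-facet-impure {k} {j} {U₁} {U₂} {Q} S j<k Q⊆Fj =
    1+n≢n (sym (trans (pure k (≤-trans (s≤s z≤n) j<k) Q Q-face Q-maximal) (length-split S)))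
    where
      Q-face : InIntersection Fs k Q
      Q-face = Q-unique S , Q⊆F S , j , j<k , Q⊆Fj
      no-earlier-facet-through : ∀ {i U} → toℕ i < toℕ k → Q ⊆ lookup Fs i →
                                 U ∈ U₁ ∷ U₂ ∷ [] → U ∈ lookup Fs i → ⊥
      no-earlier-facet-through {i} i<k Q⊆Fi U∈ U∈Fi =
        <-irrefl (cong toℕ (facets-distinct i k Fi⊆Fk Fk⊆Fi)) i<k
        where
          Fi⊆Fk : lookup Fs i ⊆ lookup Fs k
          Fi⊆Fk = maxChain-through-⊆ S (facet i) Q⊆Fi U∈ U∈Fi
          Fk⊆Fi : lookup Fs k ⊆ lookup Fs i
          Fk⊆Fi = proj₂ (facet i) (lookup Fs k) (proj₁ (facet k)) Fi⊆Fk
      Q-maximal : ∀ H → InIntersection Fs k H → Q ⊆ H → H ⊆ Q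
      Q-maximal H (_ , H⊆Fk , i , i<k , H⊆Fi) Q⊆H z∈H with split⊆ S (H⊆Fk z∈H)
      ... | here refl = ⊥-elim (no-earlier-facet-through i<k (H⊆Fi ∘ Q⊆H) (here refl) (H⊆Fi z∈H))
      ... | there (here refl) = ⊥-elim (no-earlier-facet-through i<k (H⊆Fi ∘ Q⊆H) (there (here refl)) (H⊆Fi z∈H))
      ... | there (there z∈Q) = z∈Q

  neither? : ∀ X₁ X₂ z → Dec (z ≢ X₁ × z ≢ X₂)
  neither? X₁ X₂ z = ¬? (z ≟ᴰ X₁) ×-dec ¬? (z ≟ᴰ X₂)

  without : Diagram → Diagram → List Diagram → List Diagram
  without X₁ X₂ = filter (neither? X₁ X₂)

  split-of-maxChain : ∀ {F X₁ X₂} → IsMaxChain D F → ThinChain T B X₁ X₂ → T ∷ X₁ ∷ X₂ ∷ B ∷ [] ⊆ F →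
                      Split F X₁ X₂ (without X₁ X₂ F)
  split-of-maxChain {F} {X₁} {X₂} maxF X C⊆F = record
    { thin = X
    ; maximal = maxF
    ; split⊆ = split⊆′
    ; ⊆split = λ { (here refl) → C⊆F (there (here refl))
                 ; (there (here refl)) → C⊆F (there (there (here refl)))
                 ; (there (there q)) → proj₁ (∈-filter⁻ P? {xs = F} q) }
    ; U₁∉Q = λ q → proj₁ (proj₂ (∈-filter⁻ P? {xs = F} q)) refl
    ; U₂∉Q = λ q → proj₂ (proj₂ (∈-filter⁻ P? {xs = F} q)) refl
    ; Q-unique = Unique.filter⁺ P? (proj₁ (proj₂ (proj₁ maxF)))
    ; T∈Q = ∈-filter⁺ P? (C⊆F (here refl)) (outside-≢U₁ X (inj₁ ε) , outside-≢U₂ X (inj₁ ε))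
    ; B∈Q = ∈-filter⁺ P? (C⊆F (there (there (there (here refl))))) (outside-≢U₁ X (inj₂ ε) , outside-≢U₂ X (inj₂ ε))
    }
    where
      P? : ∀ z → Dec (z ≢ X₁ × z ≢ X₂)
      P? = neither? X₁ X₂
      split⊆′ : F ⊆ X₁ ∷ X₂ ∷ without X₁ X₂ F
      split⊆′ {z} z∈F with z ≟ᴰ X₁ | z ≟ᴰ X₂
      ... | yes refl | _ = here refl
      ... | no _ | yes refl = there (here refl)
      ... | no z≢X₁ | no z≢X₂ = there (there (∈-filter⁺ P? z∈F (z≢X₁ , z≢X₂)))

  swap-maxChain : ∀ {F X₁ X₂ Y₁ Y₂ Q} → Split F X₁ X₂ Q → ThinChain T B Y₁ Y₂ → Y₁ ∉ Q → Y₂ ∉ Q →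
                  IsMaxChain D (Y₁ ∷ Y₂ ∷ Q)
  swap-maxChain {Y₁ = Y₁} {Y₂} {Q} S Y Y₁∉Q Y₂∉Q = chain , maximal′
    where
      Y₁∈P : InP D Y₁
      Y₁∈P = ⪯-trans (U₁⪯T Y) (∈F⇒∈P S (Q⊆F S (T∈Q S)))
      Q-chain : IsChain D Q
      Q-chain = All.tabulate (∈F⇒∈P S ∘ Q⊆F S) , Q-unique S , λ p q → F-comparable S (Q⊆F S p) (Q⊆F S q)
      chain : IsChain D (Y₁ ∷ Y₂ ∷ Q)
      chain = chain-∷ {D}
        (chain-∷ {D} Q-chain (⪯-trans (U₂⪯U₁ Y) Y₁∈P) Y₂∉Q (comparable-sym ∘ outside-comparable-U₂ Y ∘ Q-outside S))
        Y₁∈P (λ { (here Y₁≡Y₂) → U₁≢U₂ Y Y₁≡Y₂ ; (there Y₁∈Q) → Y₁∉Q Y₁∈Q })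
        (λ { (here refl) → inj₂ (U₂⪯U₁ Y) ; (there q∈Q) → comparable-sym (outside-comparable-U₁ Y (Q-outside S q∈Q)) })
      maximal′ : ∀ G → IsChain D G → Y₁ ∷ Y₂ ∷ Q ⊆ G → G ⊆ Y₁ ∷ Y₂ ∷ Q
      maximal′ G (inG , _ , cmpG) ⊆G {z} z∈G
        with comparable-middle Y (here refl) (cmpG z∈G (⊆G (there (there (T∈Q S)))))
               (cmpG z∈G (⊆G (there (there (B∈Q S))))) (cmpG z∈G (⊆G (here refl)))
      ... | inj₁ out = there (there (outside-∈Q S (All.lookup inG z∈G) out (λ q∈Q → cmpG z∈G (⊆G (there (there q∈Q))))))
      ... | inj₂ (inj₁ refl) = here refl
      ... | inj₂ (inj₂ refl) = there (here refl)

  split-facets-clash : ∀ {a b X₁ X₂ Y₁ Y₂ Q} → Split (lookup Fs a) X₁ X₂ Q → Split (lookup Fs b) Y₁ Y₂ Q →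
                       weight X₁ ≡ weight Y₁ → X₁ ≢ Y₁ → ⊥
  split-facets-clash {a} {b} {Y₁ = Y₁} Sa Sb w≡ X₁≢Y₁ with <-cmp (toℕ a) (toℕ b)
  ... | tri< a<b _ _ = split-later-facet-impure Sb a<b (Q⊆F Sa)
  ... | tri> _ _ b<a = split-later-facet-impure Sa b<a (Q⊆F Sb)
  ... | tri≈ _ a≡b _ = X₁≢Y₁ (chain-weight-injective {D} (F-chain Sa) (⊆split Sa (here refl)) Y₁∈Fa w≡)
    where
      Y₁∈Fa : Y₁ ∈ lookup Fs a
      Y₁∈Fa = subst (λ i → Y₁ ∈ lookup Fs i) (sym (toℕ-injective a≡b)) (⊆split Sb (here refl))

  thinChains-clash : ∀ {X₁ X₂ Y₁ Y₂} → InP D T → ThinChain T B X₁ X₂ → ThinChain T B Y₁ Y₂ →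
                     X₁ ≢ Y₁ → X₂ ≢ Y₂ → ⊥
  thinChains-clash {X₁} {X₂} {Y₁} {Y₂} T∈P X Y X₁≢Y₁ X₂≢Y₂ = ¬¬maxChain-⊇ D _ (thin-chain X {D} T∈P) clash
    where
      weight-X₁≡Y₁ : weight X₁ ≡ weight Y₁
      weight-X₁≡Y₁ = suc-injective (trans (sym (weight-T X)) (weight-T Y))
      weight-X₂≡Y₂ : weight X₂ ≡ weight Y₂
      weight-X₂≡Y₂ = trans (weight-U₂ X) (sym (weight-U₂ Y))
      clash : ¬ (∃ λ M → IsMaxChain D M × T ∷ X₁ ∷ X₂ ∷ B ∷ [] ⊆ M)
      clash (M , maxM , C⊆M) = split-facets-clash Sa Sb weight-X₁≡Y₁ X₁≢Y₁
        where
          a : Fin (length Fs)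
          a = proj₁ (complete M maxM)
          Q : List Diagram
          Q = without X₁ X₂ (lookup Fs a)
          Sa : Split (lookup Fs a) X₁ X₂ Q
          Sa = split-of-maxChain (facet a) X (proj₁ (proj₂ (complete M maxM)) ∘ C⊆M)
          ∉Q : ∀ {X Y} → X ∈ lookup Fs a → weight X ≡ weight Y → X ≢ Y → Y ∉ Q
          ∉Q X∈Fa w≡ X≢Y Y∈Q = X≢Y (chain-weight-injective {D} (F-chain Sa) X∈Fa (Q⊆F Sa Y∈Q) w≡)
          Y₁∉Q : Y₁ ∉ Q
          Y₁∉Q = ∉Q (⊆split Sa (here refl)) weight-X₁≡Y₁ X₁≢Y₁
          Y₂∉Q : Y₂ ∉ Q
          Y₂∉Q = ∉Q (⊆split Sa (there (here refl))) weight-X₂≡Y₂ X₂≢Y₂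
          maxF′ : IsMaxChain D (Y₁ ∷ Y₂ ∷ Q)
          maxF′ = swap-maxChain Sa Y Y₁∉Q Y₂∉Q
          b : Fin (length Fs)
          b = proj₁ (complete _ maxF′)
          Sb : Split (lookup Fs b) Y₁ Y₂ Q
          Sb = record
            { thin = Y ; maximal = facet b
            ; split⊆ = proj₂ (proj₂ (complete _ maxF′)) ; ⊆split = proj₁ (proj₂ (complete _ maxF′))
            ; U₁∉Q = Y₁∉Q ; U₂∉Q = Y₂∉Q
            ; Q-unique = Q-unique Sa ; T∈Q = T∈Q Sa ; B∈Q = B∈Q Sa }

thinChains⇒¬Shellable : ∀ D {T B X₁ X₂ Y₁ Y₂} → InP D T → ThinChain T B X₁ X₂ → ThinChain T B Y₁ Y₂ →
                        X₁ ≢ Y₁ → X₂ ≢ Y₂ → ¬ Shellable D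
thinChains⇒¬Shellable D {T} {B} T∈P X Y X₁≢Y₁ X₂≢Y₂ (Fs , facet , complete , distinct , pure) =
  Shelling.thinChains-clash {D} Fs facet complete distinct pure T B T∈P X Y X₁≢Y₁ X₂≢Y₂

-- Moves lowering a cell by one row

record OneRowMove (A Z : Diagram) : Set where
  field
    from to : Cell
    from∈ : from ∈ A
    same-col : col to ≡ col from
    one-row-down : row from ≡ suc (row to)
    rightmost : maxCol (row from) A ≡ just (col from)
    result : Z ≡ relocate from to A

weight-one-row-down : ∀ L a a' → Sorted L → a ∈ L → a' ∉ L → row a ≡ suc (row a') →
                      weight L ≡ suc (weight (relocate a a' L))
weight-one-row-down L a a' sL a∈L a'∉L down = begin
  weight L                                         ≡⟨ sym (weight-removeCell-sorted a L sL a∈L) ⟩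
  weight (removeCell a L) + row a                  ≡⟨ cong (weight (removeCell a L) +_) down ⟩
  weight (removeCell a L) + suc (row a')           ≡⟨ +-suc _ (row a') ⟩
  suc (weight (removeCell a L) + row a')           ≡⟨ cong suc (+-comm _ (row a')) ⟩
  suc (row a' + weight (removeCell a L))           ≡⟨ cong suc (sym (weight-insertCell-∉ a' _ a'∉)) ⟩
  suc (weight (relocate a a' L))                   ∎
  where
    open ≡-Reasoning
    a'∉ : a' ∉ removeCell a L
    a'∉ = a'∉L ∘ proj₂ ∘ ∈-removeCell⁻ a L

kstep-weight-suc⇒move : ∀ {A Z} → Sorted A → KStep A Z → weight A ≡ suc (weight Z) → OneRowMove A Z
kstep-weight-suc⇒move {A} sA (k , refl) w≡ with kohnert k A | kohnertView k A
... | _ | unchanged = ⊥-elim (1+n≢n (sym w≡))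
... | _ | moved c r' eqc eqr = record
  { from = k , c ; to = r' , c ; from∈ = maxCol-∈ k A eqc
  ; same-col = refl ; one-row-down = k≡1+r' ; rightmost = eqc ; result = refl }
  where
    R : List Cell
    R = removeCell (k , c) A
    r'∉R : (r' , c) ∉ R
    r'∉R = findFree-∉ (k ∸ 1) c A eqr ∘ proj₂ ∘ ∈-removeCell⁻ (k , c) A
    k≡1+r' : k ≡ suc r'
    k≡1+r' = +-cancelˡ-≡ (weight R) k (suc r') (begin
      weight R + k                         ≡⟨ weight-removeCell-sorted (k , c) A sA (maxCol-∈ k A eqc) ⟩
      weight A                             ≡⟨ w≡ ⟩
      suc (weight (insertCell (r' , c) R)) ≡⟨ cong suc (weight-insertCell-∉ (r' , c) R r'∉R) ⟩
      suc (r' + weight R)                  ≡⟨ cong suc (+-comm r' (weight R)) ⟩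
      suc (weight R + r')                  ≡⟨ sym (+-suc (weight R) r') ⟩
      weight R + suc r'                    ∎)
      where open ≡-Reasoning

⪯-weight-suc⇒move : ∀ {A Z} → Sorted A → Z ⪯ A → weight A ≡ suc (weight Z) → OneRowMove A Z
⪯-weight-suc⇒move sA ε w≡ = ⊥-elim (1+n≢n (sym w≡))
⪯-weight-suc⇒move {A} sA ((k , A₁≡) ◅ rest) w≡ with kohnert-weight k A
... | inj₁ kA≡A with trans A₁≡ kA≡A
...   | refl = ⪯-weight-suc⇒move sA rest w≡
⪯-weight-suc⇒move {A} sA ((k , A₁≡) ◅ rest) w≡ | inj₂ lowered with ⪯⇒≡⊎weight< rest
... | inj₁ refl = kstep-weight-suc⇒move sA (k , A₁≡) w≡
... | inj₂ Z<A₁ = ⊥-elim (<⇒≱ Z<A₁ (≤-pred (subst₂ _<_ (cong weight (sym A₁≡)) w≡ lowered)))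

between-covers⇒moves : ∀ {L M N z} → Sorted L → M ⋖ L → N ⋖ M → N ⪯ z → z ⪯ L → weight z ≡ weight M →
                       OneRowMove L z × OneRowMove z N
between-covers⇒moves sL (_ , wL) (_ , wM) N⪯z z⪯L w≡ =
  ⪯-weight-suc⇒move sL z⪯L (trans wL (cong suc (sym w≡))) ,
  ⪯-weight-suc⇒move (⪯-sorted z⪯L sL) N⪯z (trans w≡ wM)

module OneRowMoveProperties {A Z} (m : OneRowMove A Z) where
  open OneRowMove m

  ∈-move⁻ : ∀ {x} → x ∈ Z → x ≡ to ⊎ (x ≢ from × x ∈ A)
  ∈-move⁻ x∈Z = ∈-relocate⁻ from to A (subst (_ ∈_) result x∈Z)

  ∈-move⁺ : ∀ {x} → x ∈ A → x ≢ from → x ∈ Z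
  ∈-move⁺ x∈A x≢from = subst (_ ∈_) (sym result) (∈-relocate⁺ from to A x∈A x≢from)

  to∈ : to ∈ Z
  to∈ = subst (to ∈_) (sym result) (∈-relocate-target from to A)

  from∉ : from ∉ Z
  from∉ from∈Z with ∈-move⁻ from∈Z
  ... | inj₁ from≡to = <-irrefl (cong row (sym from≡to)) (≤-reflexive (sym one-row-down))
  ... | inj₂ (from≢from , _) = from≢from refl

  to-below : ∀ {R c} → from ≡ (suc R , c) → to ≡ (R , c)
  to-below refl = cong₂ _,_ (suc-injective (sym one-row-down)) same-col

  result-from : ∀ {R c} → from ≡ (suc R , c) → Z ≡ relocate (suc R , c) (R , c) A
  result-from from≡ = trans result (cong₂ (λ a a' → relocate a a' A) from≡ (to-below from≡))

  from-rightmost : ∀ {n c c'} → from ≡ (n , c) → (n , c') ∈ A → c' ≤ c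
  from-rightmost refl c'∈A = maxCol-≥ _ A rightmost c'∈A

open OneRowMoveProperties

module _ {A Z B} (m₁ : OneRowMove A Z) (m₂ : OneRowMove Z B) where
  open OneRowMove

  vacated-by-two-moves : ∀ {x} → x ∈ A → x ∉ B → x ≡ from m₁ ⊎ x ≡ from m₂
  vacated-by-two-moves {x} x∈A x∉B with x ≟ᶜ from m₁ | x ≟ᶜ from m₂
  ... | yes x≡ | _ = inj₁ x≡
  ... | no _ | yes x≡ = inj₂ x≡
  ... | no x≢₁ | no x≢₂ = ⊥-elim (x∉B (∈-move⁺ m₂ (∈-move⁺ m₁ x∈A x≢₁) x≢₂))

  two-vacated-cells : ∀ {u v} → u ∈ A → u ∉ B → v ∈ A → v ∉ B → u ≢ v →
                      from m₁ ≡ u ⊎ (from m₁ ≡ v × from m₂ ≡ u)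
  two-vacated-cells u∈A u∉B v∈A v∉B u≢v with vacated-by-two-moves u∈A u∉B | vacated-by-two-moves v∈A v∉B
  ... | inj₁ u≡ | _ = inj₁ (sym u≡)
  ... | inj₂ u≡ | inj₁ v≡ = inj₂ (sym v≡ , sym u≡)
  ... | inj₂ u≡ | inj₂ v≡ = ⊥-elim (u≢v (trans u≡ (sym v≡)))

  -- If the first move lowered another cell x, the second must refill x from
  -- directly above; but it lowers (R + 2 , c), so x = (R + 1 , c) ∉ A.
  only-vacated-cell : ∀ {R c} → (suc (suc R) , c) ∈ A → (suc (suc R) , c) ∉ B →
                      (∀ {x} → x ∈ A → x ≢ (suc (suc R) , c) → x ∈ B) → (suc R , c) ∉ A →
                      from m₁ ≡ (suc (suc R) , c)
  only-vacated-cell {R} {c} s∈A s∉B others-stay below∉A with from m₁ ≟ᶜ (suc (suc R) , c)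
  ... | yes from≡s = from≡s
  ... | no from≢s with vacated-by-two-moves s∈A s∉B
  ...   | inj₁ s≡from = ⊥-elim (from≢s (sym s≡from))
  ...   | inj₂ s≡from₂ with ∈-move⁻ m₂ (others-stay (from∈ m₁) from≢s)
  ...     | inj₂ (_ , from∈Z) = ⊥-elim (from∉ m₁ from∈Z)
  ...     | inj₁ from≡to₂ =
    ⊥-elim (below∉A (subst (_∈ A) (trans from≡to₂ (to-below m₂ (sym s≡from₂))) (from∈ m₁)))

lower-one-row : ∀ {L n c} → Sorted L → 1 ≤ n → (suc n , c) ∈ L → (∀ c' → c < c' → (suc n , c') ∉ L) →
                (n , c) ∉ L →
                relocate (suc n , c) (n , c) L ⋖ L
lower-one-row {L} {suc k} {c} sL _ s∈L rightmost below∉L =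
  (suc (suc k) , sym kohnert≡) ◅ ε , weight-one-row-down L (suc (suc k) , c) (suc k , c) sL s∈L below∉L refl
  where
    kohnert≡ : kohnert (suc (suc k)) L ≡ relocate (suc (suc k) , c) (suc k , c) L
    kohnert≡ = kohnert-moves (suc (suc k)) L (maxCol-rightmost (suc (suc k)) L c s∈L rightmost)
                             (findFree-top k c L below∉L)

-- Two routes below D*

module TwoRoutes (S : Diagram) (sS : Sorted S) (r c₁ c₂ : ℕ) (1≤r : 1 ≤ r) (c₁<c₂ : c₁ < c₂)
  (q₁∈S : (suc r , c₁) ∈ S) (s₂∈S : (suc (suc r) , c₂) ∈ S)
  (p₂∉S : (r , c₂) ∉ S) (row₂-right : ∀ c → c₂ < c → (suc (suc r) , c) ∉ S)
  (p₁∉S : (r , c₁) ∉ S) (row₁-right : ∀ c → c₁ < c → (suc r , c) ∉ S)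
  where

  p₁ p₂ q₁ q₂ s₂ : Cell
  p₁ = r , c₁
  p₂ = r , c₂
  q₁ = suc r , c₁
  q₂ = suc r , c₂
  s₂ = suc (suc r) , c₂

  r≢r+1 : r ≢ suc r
  r≢r+1 = <⇒≢ (n<1+n r)

  r≢r+2 : r ≢ suc (suc r)
  r≢r+2 = <⇒≢ (m<n⇒m<1+n (n<1+n r))

  r+1≢r+2 : suc r ≢ suc (suc r)
  r+1≢r+2 = <⇒≢ (n<1+n (suc r))

  c₁≢c₂ : c₁ ≢ c₂
  c₁≢c₂ = <⇒≢ c₁<c₂

  q₂∉S : q₂ ∉ S
  q₂∉S = row₁-right c₂ c₁<c₂

  X₁ X₂ B Y₁ Y₂ B′ : Diagram
  X₁ = relocate s₂ q₂ S
  X₂ = relocate q₂ p₂ X₁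
  B = relocate q₁ p₁ X₂
  Y₁ = relocate q₁ p₁ S
  Y₂ = relocate s₂ q₂ Y₁
  B′ = relocate q₂ p₂ Y₂

  sX₁ : Sorted X₁
  sX₁ = relocate-sorted s₂ q₂ S sS
  sX₂ : Sorted X₂
  sX₂ = relocate-sorted q₂ p₂ X₁ sX₁
  sY₁ : Sorted Y₁
  sY₁ = relocate-sorted q₁ p₁ S sS
  sY₂ : Sorted Y₂
  sY₂ = relocate-sorted s₂ q₂ Y₁ sY₁

  B′≡B : B′ ≡ B
  B′≡B = begin
    relocate q₂ p₂ (relocate s₂ q₂ (relocate q₁ p₁ S))
      ≡⟨ cong (relocate q₂ p₂) (relocate-comm s₂ q₂ q₁ p₁ S sS (cols-≢ (≢-sym c₁≢c₂)) (rows-≢ r≢r+2)) ⟩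
    relocate q₂ p₂ (relocate q₁ p₁ X₁)
      ≡⟨ relocate-comm q₂ p₂ q₁ p₁ X₁ sX₁ (rows-≢ r≢r+1) (rows-≢ r≢r+1) ⟩
    B ∎
    where open ≡-Reasoning

  q₁∈X₁ : q₁ ∈ X₁
  q₁∈X₁ = ∈-relocate⁺ s₂ q₂ S q₁∈S (rows-≢ r+1≢r+2)
  q₁∈X₂ : q₁ ∈ X₂
  q₁∈X₂ = ∈-relocate⁺ q₂ p₂ X₁ q₁∈X₁ (cols-≢ c₁≢c₂)
  q₁∉Y₁ : q₁ ∉ Y₁
  q₁∉Y₁ = relocate-source-∉ q₁ p₁ S (rows-≢ (≢-sym r≢r+1))
  q₁∉Y₂ : q₁ ∉ Y₂
  q₁∉Y₂ = ∉-relocate s₂ q₂ Y₁ (cols-≢ c₁≢c₂) q₁∉Y₁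
  q₂∉X₂ : q₂ ∉ X₂
  q₂∉X₂ = relocate-source-∉ q₂ p₂ X₁ (rows-≢ (≢-sym r≢r+1))
  q₂∉Y₁ : q₂ ∉ Y₁
  q₂∉Y₁ = ∉-relocate q₁ p₁ S (rows-≢ (≢-sym r≢r+1)) q₂∉S
  s₂∉Y₂ : s₂ ∉ Y₂
  s₂∉Y₂ = relocate-source-∉ s₂ q₂ Y₁ (rows-≢ (≢-sym r+1≢r+2))
  q₂∈X₁ : q₂ ∈ X₁
  q₂∈X₁ = ∈-relocate-target s₂ q₂ S
  q₁∉B : q₁ ∉ B
  q₁∉B = relocate-source-∉ q₁ p₁ X₂ (rows-≢ (≢-sym r≢r+1))
  q₂∉B : q₂ ∉ B
  q₂∉B = ∉-relocate q₁ p₁ X₂ (rows-≢ (≢-sym r≢r+1)) q₂∉X₂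
  s₂∉X₂ : s₂ ∉ X₂
  s₂∉X₂ = ∉-relocate q₂ p₂ X₁ (rows-≢ (≢-sym r≢r+2)) (relocate-source-∉ s₂ q₂ S (rows-≢ (≢-sym r+1≢r+2)))
  s₂∈Y₁ : s₂ ∈ Y₁
  s₂∈Y₁ = ∈-relocate⁺ q₁ p₁ S s₂∈S (rows-≢ (≢-sym r+1≢r+2))
  s₂∉B′ : s₂ ∉ B′
  s₂∉B′ = ∉-relocate q₂ p₂ Y₂ (rows-≢ (≢-sym r≢r+2)) s₂∉Y₂

  row₁-right-X₂ : ∀ c → c₁ < c → (suc r , c) ∉ X₂
  row₁-right-X₂ c c₁<c z∈ with ∈-relocate⁻ q₂ p₂ X₁ z∈
  ... | inj₁ z≡p₂ = r≢r+1 (sym (cong proj₁ z≡p₂))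
  ... | inj₂ (z≢q₂ , z∈X₁) with ∈-relocate⁻ s₂ q₂ S z∈X₁
  ...   | inj₁ z≡q₂ = z≢q₂ z≡q₂
  ...   | inj₂ (_ , z∈S) = row₁-right c c₁<c z∈S

  X₁⋖S : X₁ ⋖ S
  X₁⋖S = lower-one-row sS (s≤s z≤n) s₂∈S row₂-right q₂∉S

  X₂⋖X₁ : X₂ ⋖ X₁
  X₂⋖X₁ = lower-one-row sX₁ 1≤r (∈-relocate-target s₂ q₂ S)
    (λ c c₂<c → ∉-relocate s₂ q₂ S (cols-≢ (>⇒≢ c₂<c)) (row₁-right c (<-trans c₁<c₂ c₂<c)))
    (∉-relocate s₂ q₂ S (rows-≢ r≢r+1) p₂∉S)

  B⋖X₂ : B ⋖ X₂
  B⋖X₂ = lower-one-row sX₂ 1≤r q₁∈X₂ row₁-right-X₂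
    (∉-relocate q₂ p₂ X₁ (cols-≢ c₁≢c₂) (∉-relocate s₂ q₂ S (rows-≢ r≢r+1) p₁∉S))

  Y₁⋖S : Y₁ ⋖ S
  Y₁⋖S = lower-one-row sS 1≤r q₁∈S row₁-right p₁∉S

  Y₂⋖Y₁ : Y₂ ⋖ Y₁
  Y₂⋖Y₁ = lower-one-row sY₁ (s≤s z≤n) s₂∈Y₁
    (λ c c₂<c → ∉-relocate q₁ p₁ S (rows-≢ (≢-sym r≢r+2)) (row₂-right c c₂<c))
    q₂∉Y₁

  B′⋖Y₂ : B′ ⋖ Y₂
  B′⋖Y₂ = lower-one-row sY₂ 1≤r (∈-relocate-target s₂ q₂ Y₁)
    (λ c c₂<c → ∉-relocate s₂ q₂ Y₁ (cols-≢ (>⇒≢ c₂<c))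
                  (∉-relocate q₁ p₁ S (rows-≢ (≢-sym r≢r+1)) (row₁-right c (<-trans c₁<c₂ c₂<c))))
    (∉-relocate s₂ q₂ Y₁ (rows-≢ r≢r+1) (∉-relocate q₁ p₁ S (cols-≢ (≢-sym c₁≢c₂)) p₂∉S))

  B⋖Y₂ : B ⋖ Y₂
  B⋖Y₂ = subst (_⋖ Y₂) B′≡B B′⋖Y₂

  X₂-unique : ∀ z → B ⪯ z → z ⪯ X₁ → weight z ≡ weight X₂ → z ≡ X₂
  X₂-unique z B⪯z z⪯X₁ w≡ with between-covers⇒moves sX₁ X₂⋖X₁ B⋖X₂ B⪯z z⪯X₁ w≡
  ... | m₁ , m₂ with two-vacated-cells m₁ m₂ q₂∈X₁ q₂∉B q₁∈X₁ q₁∉B (cols-≢ (≢-sym c₁≢c₂))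
  ...   | inj₁ from≡q₂ = result-from m₁ from≡q₂
  ...   | inj₂ (from≡q₁ , _) = ⊥-elim (<⇒≱ c₁<c₂ (from-rightmost m₁ from≡q₁ q₂∈X₁))

  X₁-unique : ∀ z → X₂ ⪯ z → z ⪯ S → weight z ≡ weight X₁ → z ≡ X₁
  X₁-unique z X₂⪯z z⪯S w≡ with between-covers⇒moves sS X₁⋖S X₂⋖X₁ X₂⪯z z⪯S w≡
  ... | m₁ , m₂ = result-from m₁ (only-vacated-cell m₁ m₂ s₂∈S s₂∉X₂ stays q₂∉S)
    where
      stays : ∀ {x} → x ∈ S → x ≢ s₂ → x ∈ X₂
      stays x∈S x≢s₂ = ∈-relocate⁺ q₂ p₂ X₁ (∈-relocate⁺ s₂ q₂ S x∈S x≢s₂) (λ { refl → q₂∉S x∈S })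

  Y₂-unique : ∀ z → B ⪯ z → z ⪯ Y₁ → weight z ≡ weight Y₂ → z ≡ Y₂
  Y₂-unique z B⪯z z⪯Y₁ w≡ with between-covers⇒moves sY₁ Y₂⋖Y₁ B′⋖Y₂ (subst (_⪯ z) (sym B′≡B) B⪯z) z⪯Y₁ w≡
  ... | m₁ , m₂ = result-from m₁ (only-vacated-cell m₁ m₂ s₂∈Y₁ s₂∉B′ stays q₂∉Y₁)
    where
      stays : ∀ {x} → x ∈ Y₁ → x ≢ s₂ → x ∈ B′
      stays x∈Y₁ x≢s₂ = ∈-relocate⁺ q₂ p₂ Y₂ (∈-relocate⁺ s₂ q₂ Y₁ x∈Y₁ x≢s₂) (λ { refl → q₂∉Y₁ x∈Y₁ })

  Y₁-unique : ∀ z → Y₂ ⪯ z → z ⪯ S → weight z ≡ weight Y₁ → z ≡ Y₁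
  Y₁-unique z Y₂⪯z z⪯S w≡ with between-covers⇒moves sS Y₁⋖S Y₂⋖Y₁ Y₂⪯z z⪯S w≡
  ... | m₁ , m₂ with two-vacated-cells m₁ m₂ q₁∈S q₁∉Y₂ s₂∈S s₂∉Y₂ (rows-≢ r+1≢r+2)
  ...   | inj₁ from≡q₁ = result-from m₁ from≡q₁
  ...   | inj₂ (from₁≡s₂ , from₂≡q₁) = ⊥-elim (<⇒≱ c₁<c₂ (from-rightmost m₂ from₂≡q₁ q₂∈z))
    where
      q₂∈z : q₂ ∈ z
      q₂∈z = subst (_∈ z) (to-below m₁ from₁≡s₂) (to∈ m₁)

  X : ThinChain S B X₁ X₂
  X = record { U₁⋖T = X₁⋖S ; U₂⋖U₁ = X₂⋖X₁ ; B⋖U₂ = B⋖X₂ ; U₂-unique = X₂-unique ; U₁-unique = X₁-unique }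

  Y : ThinChain S B Y₁ Y₂
  Y = record { U₁⋖T = Y₁⋖S ; U₂⋖U₁ = Y₂⋖Y₁ ; B⋖U₂ = B⋖Y₂ ; U₂-unique = Y₂-unique ; U₁-unique = Y₁-unique }

  X₁≢Y₁ : X₁ ≢ Y₁
  X₁≢Y₁ X₁≡Y₁ = q₁∉Y₁ (subst (q₁ ∈_) X₁≡Y₁ q₁∈X₁)

  X₂≢Y₂ : X₂ ≢ Y₂
  X₂≢Y₂ X₂≡Y₂ = q₁∉Y₂ (subst (q₁ ∈_) X₂≡Y₂ q₁∈X₂)

proposition3p6 : (D : List Cell) → IsDiagram D →
    (Dstar : Diagram) → InP D Dstar →
    (r c₁ c₂ : ℕ) → 1 ≤ r → 1 ≤ c₁ → 1 ≤ c₂ →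
    c₁ < c₂ →
    (r + 1 , c₁) ∈ Dstar → (r + 2 , c₂) ∈ Dstar →
    (r , c₂) ∉ Dstar → (∀ c → c₂ < c → (r + 2 , c) ∉ Dstar) →
    (r , c₁) ∉ Dstar → (∀ c → c₁ < c → (r + 1 , c) ∉ Dstar) →
    ¬ Shellable D
proposition3p6 D _ S S∈P r c₁ c₂ 1≤r _ _ c₁<c₂ q₁∈S s₂∈S p₂∉S row₂-right p₁∉S row₁-right =
  thinChains⇒¬Shellable D S∈P X Y X₁≢Y₁ X₂≢Y₂
  where
    r+1≡ : r + 1 ≡ suc r
    r+1≡ = +-comm r 1
    r+2≡ : r + 2 ≡ suc (suc r)
    r+2≡ = +-comm r 2
    open TwoRoutes S (⪯-sorted S∈P (canon-sorted D)) r c₁ c₂ 1≤r c₁<c₂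
      (subst (λ n → (n , c₁) ∈ S) r+1≡ q₁∈S) (subst (λ n → (n , c₂) ∈ S) r+2≡ s₂∈S)
      p₂∉S (λ c c₂<c → subst (λ n → (n , c) ∉ S) r+2≡ (row₂-right c c₂<c))
      p₁∉S (λ c c₁<c → subst (λ n → (n , c) ∉ S) r+1≡ (row₁-right c c₁<c))
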